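{- Let $T$ be a tree with $n\ge 2$ vertices and radius $r\ge 1$. Then every graph containing no subgraph isomorphic to $T$ is $(r,n-2)$-colourable.
   Context: A graph is $(k,d)$-colourable if each vertex can be given one of $k$ colours so that each vertex has at most $d$ neighbours of its own colour. -}

module Defs where

open import Data.Nat using (ℕ; zero; suc; _+_; _≤_; _<_)
open import Data.Bool using (Bool; true; false; _∧_; if_then_else_)
open import Data.Fin using (Fin)
open import Data.Fin.Properties using (_≟_)
open import Data.List using (List; map)
open import Data.Nat.ListAction using (sum)
open import Data.List using (allFin)
open import Data.Product using (Σ; ∃; _×_; _,_)
open import Relation.Nullary using (¬_; does)
open import Relation.Binary.PropositionalEquality using (_≡_)
open import Function.Definitions using (Injective)

record Graph (m : ℕ) : Set where
  field
    adj    : Fin m → Fin m → Bool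
    sym    : ∀ u v → adj u v ≡ adj v u
    irrefl : ∀ v → adj v v ≡ false

open Graph public

Edge : ∀ {m} → Graph m → Fin m → Fin m → Set
Edge G u v = adj G u v ≡ true

data Walk {m : ℕ} (G : Graph m) : Fin m → Fin m → ℕ → Set where
  here : ∀ {v} → Walk G v v zero
  step : ∀ {u w v k} → Edge G u w → Walk G w v k → Walk G u v (suc k)

DistLE : ∀ {m} → Graph m → Fin m → Fin m → ℕ → Set
DistLE G u v k = Σ ℕ λ j → j ≤ k × Walk G u v j

Connected : ∀ {m} → Graph m → Set
Connected G = ∀ u v → Σ ℕ λ k → Walk G u v k

-- A cycle: k ≥ 3 distinct vertices c 0, …, c (k-1) with consecutive ones
-- adjacent and c (k-1) adjacent to c 0.
-- Encoded with k = suc (suc (suc j)), vertices indexed by Fin k.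
open import Data.Fin using (toℕ; fromℕ; inject₁; zero; suc)

HasCycle : ∀ {m} → Graph m → Set
HasCycle {m} G =
  Σ ℕ λ j → Σ (Fin (suc (suc (suc j))) → Fin m) λ c →
    Injective _≡_ _≡_ c ×
    (∀ (i : Fin (suc (suc j))) → Edge G (c (inject₁ i)) (c (suc i))) ×
    Edge G (c (fromℕ (suc (suc j)))) (c zero)

Acyclic : ∀ {m} → Graph m → Set
Acyclic G = ¬ HasCycle G

IsTree : ∀ {n} → Graph n → Set
IsTree T = Connected T × Acyclic T

-- The radius of G is r: some vertex has eccentricity ≤ r, and every vertex
-- has eccentricity ≥ r (i.e. min over v of max over u of dist(v,u) equals r).
HasRadius : ∀ {n} → Graph n → ℕ → Set
HasRadius G r =
  (Σ _ λ c → ∀ u → DistLE G c u r) ×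
  (∀ v → Σ _ λ u → ∀ k → k < r → ¬ DistLE G v u k)

-- G contains a (not necessarily induced) subgraph isomorphic to H:
-- an injective vertex map preserving edges.
ContainsSubgraph : ∀ {m n} → Graph m → Graph n → Set
ContainsSubgraph {m} {n} G H =
  Σ (Fin n → Fin m) λ f → Injective _≡_ _≡_ f ×
    (∀ a b → Edge H a b → Edge G (f a) (f b))

sameColourDeg : ∀ {m k} → Graph m → (Fin m → Fin k) → Fin m → ℕ
sameColourDeg {m} G col v =
  sum (map (λ u → if adj G v u ∧ does (col u ≟ col v) then 1 else 0) (allFin m))

Colourable : ∀ {m} → Graph m → ℕ → ℕ → Set
Colourable {m} G k d =
  Σ (Fin m → Fin k) λ col → ∀ v → sameColourDeg G col v ≤ d

-- Fix a graph G and a number d, and repeatedly delete, simultaneously, all vertices having at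
-- most d neighbours among the vertices still present; core k is the set surviving k rounds.
--
--  * Peeling colouring: if core r is empty, colour every vertex by the round (< r) in which it
--    is deleted.  A neighbour of the same colour was still present in that round, and the vertex
--    had at most d neighbours then, so this is an (r, d)-colouring.
--  * Greedy embedding: let T have n ≤ d + 2 vertices, be rooted with all depths ≤ R, and have
--    only parent–child edges.  Send the root to a vertex of core R and, parents first, a vertex
--    of depth k + 1 to an unused neighbour inside core (R - k - 1) of its parent's image: that
--    image lies in core (R - k), so it has more than d ≥ n - 2 such neighbours.
--
-- With d = n - 2 the
-- theorem follows: a vertex in core r yields a copy of T, so core r is empty.
module Submission where

open import Data.Bool using (Bool; true; false; _∧_; if_then_else_)
open import Data.Bool.Properties using (¬-not; ∧-conicalˡ; ∧-conicalʳ) renaming (_≟_ to _≟ᵇ_)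
open import Data.Empty using (⊥)
open import Data.Fin using (Fin; toℕ; fromℕ<)
open import Data.Fin.Properties
  using (any?; toℕ-fromℕ<; toℕ-injective; toℕ<n; toℕ-fromℕ; toℕ-inject₁)
  renaming (_≟_ to _≟ᶠ_)
open import Data.List using (List; []; _∷_; _++_; map; length; allFin; filter)
open import Data.List.Properties using (length-map; length-++-sucʳ; length-tabulate)
open import Data.List.Membership.Propositional using (_∈_; _∉_)
open import Data.List.Membership.Propositional.Properties
  using (∈-allFin; ∈-∃++; ∈-++⁻; ∈-++⁺ˡ; ∈-++⁺ʳ; ∈-map⁺; ∈-filter⁺; ∈-filter⁻)
open import Data.List.Relation.Unary.Any using (here; there)
open import Data.List.Relation.Unary.All using (lookup)
import Data.List.Membership.DecPropositional as DecMembership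
open import Data.List.Relation.Unary.All.Properties using (¬Any⇒All¬)
open import Data.List.Relation.Unary.Unique.Propositional using (Unique; []; _∷_)
open import Data.List.Relation.Unary.Unique.Propositional.Properties
  using (allFin⁺; filter⁺)
open import Data.Nat using (ℕ; zero; suc; _+_; _∸_; _≤_; _<_; z≤n; s≤s; s≤s⁻¹; _≟_; _≤?_)
open import Data.Nat.Properties
open import Data.Nat.ListAction using (sum)
open import Data.Product using (Σ; _×_; _,_; proj₁; proj₂)
open import Data.Sum using (_⊎_; inj₁; inj₂)
open import Function using (_∘_)
open import Relation.Nullary using (¬_; Dec; yes; no; does; ¬?; contradiction)
open import Relation.Nullary.Decidable using (_×-dec_; _⊎-dec_; map′; dec-true; dec-false; decidable-stable)
open import Relation.Unary using (Decidable)
open import Relation.Binary.PropositionalEquality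
open import Defs renaming (sym to adj-sym)

∸≡suc∸suc : ∀ {m i} → i < m → m ∸ i ≡ suc (m ∸ suc i)
∸≡suc∸suc = +-∸-assoc 1

positive : ∀ {d} → 1 ≤ d → Σ ℕ λ k → d ≡ suc k
positive {suc k} _ = k , refl

from-does : ∀ {A : Set} (a? : Dec A) → does a? ≡ true → A
from-does (yes a) _ = a

Least : (ℕ → Set) → ℕ → Set
Least P k = P k × (∀ j → j < k → ¬ P j)

least : ∀ {P : ℕ → Set} → Decidable P → ∀ b → P b → Σ ℕ λ k → k ≤ b × Least P k
least P? zero p = 0 , z≤n , p , λ _ ()
least {P} P? (suc b) p with P? 0
... | yes p₀ = 0 , z≤n , p₀ , λ _ ()
... | no ¬p₀ with least (P? ∘ suc) b p
...   | k , k≤b , pk , below = suc k , s≤s k≤b , pk , earlier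
  where
    earlier : ∀ j → j < suc k → ¬ P j
    earlier zero _ = ¬p₀
    earlier (suc j) (s≤s j<k) = below j j<k

countIn : {A : Set} → (A → Bool) → List A → ℕ
countIn P xs = sum (map (λ u → if P u then 1 else 0) xs)

count : ∀ {m} → (Fin m → Bool) → ℕ
count P = countIn P (allFin _)

countIn-mono : ∀ {A : Set} {P Q : A → Bool} xs →
  (∀ u → P u ≡ true → Q u ≡ true) → countIn P xs ≤ countIn Q xs
countIn-mono [] _ = z≤n
countIn-mono {P = P} {Q} (x ∷ xs) P⇒Q with P x in px | Q x in qx
... | false | _     = ≤-trans (countIn-mono xs P⇒Q) (m≤n+m _ _)
... | true  | true  = s≤s (countIn-mono xs P⇒Q)
... | true  | false = contradiction (trans (sym qx) (P⇒Q x px)) λ ()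

∈-delete : ∀ {A : Set} {u w : A} ys zs → u ∈ ys ++ w ∷ zs → u ≢ w → u ∈ ys ++ zs
∈-delete ys zs u∈ u≢w with ∈-++⁻ ys u∈
... | inj₁ u∈ys          = ∈-++⁺ˡ u∈ys
... | inj₂ (here refl)   = contradiction refl u≢w
... | inj₂ (there u∈zs)  = ∈-++⁺ʳ ys u∈zs

countIn-≤-length : ∀ {A : Set} {P : A → Bool} {xs} U → Unique xs →
  (∀ u → u ∈ xs → P u ≡ true → u ∈ U) → countIn P xs ≤ length U
countIn-≤-length U [] _ = z≤n
countIn-≤-length {P = P} {x ∷ xs} U (x≢xs ∷ xs!) inU with P x in px
... | false = countIn-≤-length U xs! (λ u u∈ → inU u (there u∈))
... | true with ∈-∃++ (inU x (here refl) px)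
...   | ys , zs , refl =
  subst (suc (countIn P xs) ≤_) (sym (length-++-sucʳ ys x zs))
    (s≤s (countIn-≤-length (ys ++ zs) xs! λ u u∈ pu →
      ∈-delete ys zs (inU u (there u∈) pu) λ { refl → lookup x≢xs u∈ refl }))

unique-length : ∀ {m} {xs : List (Fin m)} → Unique xs → length xs ≤ m
unique-length {m} {xs} xs! =
  subst₂ _≤_ (countIn-true xs) (length-tabulate (λ i → i))
    (countIn-≤-length (allFin m) xs! λ u _ _ → ∈-allFin u)
  where
    countIn-true : ∀ ys → countIn (λ _ → true) ys ≡ length ys
    countIn-true [] = refl
    countIn-true (_ ∷ ys) = cong suc (countIn-true ys)

_∈ᶠ?_ : ∀ {m} (u : Fin m) (U : List (Fin m)) → Dec (u ∈ U)
_∈ᶠ?_ = DecMembership._∈?_ _≟ᶠ_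

fresh : ∀ {m} (P : Fin m → Bool) {w U} → w ∈ U → P w ≡ false → length U ≤ count P →
  Σ (Fin m) λ u → P u ≡ true × u ∉ U
fresh {m} P {w} {U} w∈U pw big
  with any? (λ u → (P u ≟ᵇ true) ×-dec ¬? (u ∈ᶠ? U))
... | yes (u , pu , u∉U) = u , pu , u∉U
... | no none with ∈-∃++ w∈U
...   | ys , zs , refl = contradiction big (<⇒≱ (begin-strict
  count P             ≤⟨ countIn-≤-length (ys ++ zs) (allFin⁺ m) inRest ⟩
  length (ys ++ zs)   <⟨ ≤-reflexive (sym (length-++-sucʳ ys w zs)) ⟩
  length (ys ++ w ∷ zs) ∎))
  where
    open ≤-Reasoning
    inRest : ∀ u → u ∈ allFin m → P u ≡ true → u ∈ ys ++ zs
    inRest u _ pu = ∈-delete ys zs (decidable-stable (u ∈ᶠ? _) λ u∉ → none (u , pu , u∉))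
      λ { refl → contradiction (trans (sym pw) pu) λ () }

edge-sym : ∀ {m} (G : Graph m) {u v} → Edge G u v → Edge G v u
edge-sym G {u} {v} e = trans (adj-sym G v u) e

no-loop : ∀ {m} (G : Graph m) {u} → ¬ Edge G u u
no-loop G {u} e = contradiction (trans (sym e) (irrefl G u)) λ ()

closedWalk⇒cycle : ∀ {m} (G : Graph m) (h : ℕ → Fin m) N → 2 ≤ N →
  (∀ {k k'} → k ≤ N → k' ≤ N → h k ≡ h k' → k ≡ k') →
  (∀ k → k < N → Edge G (h k) (h (suc k))) → Edge G (h N) (h 0) → HasCycle G
closedWalk⇒cycle G h (suc (suc L)) (s≤s (s≤s z≤n)) distinct consecutive close =
  L , h ∘ toℕ ,
  (λ e → toℕ-injective (distinct (s≤s⁻¹ (toℕ<n _)) (s≤s⁻¹ (toℕ<n _)) e)) ,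
  (λ i → subst (λ t → Edge G (h t) (h (suc (toℕ i)))) (sym (toℕ-inject₁ i))
           (consecutive (toℕ i) (toℕ<n i))) ,
  subst (λ t → Edge G (h t) (h 0)) (sym (toℕ-fromℕ _)) close

record Rooted {n} (T : Graph n) (R : ℕ) : Set where
  field
    root          : Fin n
    depth         : Fin n → ℕ
    parent        : Fin n → Fin n
    depth-≤       : ∀ x → depth x ≤ R
    depth-root    : depth root ≡ 0
    depth-zero    : ∀ x → depth x ≡ 0 → x ≡ root
    parent-depth  : ∀ {x k} → depth x ≡ suc k → depth (parent x) ≡ k
    parent-edge   : ∀ {x k} → depth x ≡ suc k → Edge T (parent x) x

module BreadthFirst {n} (T : Graph n) (c : Fin n) where

  Ball : ℕ → Fin n → Set
  Ball zero x = x ≡ c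
  Ball (suc k) x = Ball k x ⊎ Σ (Fin n) λ y → Ball k y × Edge T y x

  ball? : ∀ k → Decidable (Ball k)
  ball? zero x = x ≟ᶠ c
  ball? (suc k) x = ball? k x ⊎-dec any? λ y → ball? k y ×-dec (adj T y x ≟ᵇ true)

  walk-ball : ∀ {k u x j} → Ball k u → Walk T u x j → Ball (k + j) x
  walk-ball {k} b here rewrite +-identityʳ k = b
  walk-ball {k} {j = suc j} b (step e w) rewrite +-suc k j = walk-ball (inj₂ (_ , b , e)) w

  module _ {R} (near : ∀ x → DistLE T c x R) where

    first-reached : ∀ x → Σ ℕ λ k → k ≤ R × Least (λ j → Ball j x) k
    first-reached x with near x
    ... | j , j≤R , w with least (λ i → ball? i x) j (walk-ball refl w)
    ...   | k , k≤j , first = k , ≤-trans k≤j j≤R , first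

    depth : Fin n → ℕ
    depth x = proj₁ (first-reached x)

    reached : ∀ x → Ball (depth x) x
    reached x = proj₁ (proj₂ (proj₂ (first-reached x)))

    unreached : ∀ x j → j < depth x → ¬ Ball j x
    unreached x = proj₂ (proj₂ (proj₂ (first-reached x)))

    depth-≤ball : ∀ {x j} → Ball j x → depth x ≤ j
    depth-≤ball {x} {j} b = ≮⇒≥ λ j<d → unreached x j j<d b

    earlier-neighbour : ∀ x {k} → depth x ≡ suc k → Σ (Fin n) λ y → depth y ≡ k × Edge T y x
    earlier-neighbour x {k} dx with subst (λ t → Ball t x) dx (reached x)
    ... | inj₁ b = contradiction b (unreached x k (≤-reflexive (sym dx)))
    ... | inj₂ (y , b , e) = y , ≤-antisym (depth-≤ball b) (≮⇒≥ too-early) , e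
      where
        too-early : depth y < k → ⊥
        too-early dy<k = unreached x (suc (depth y)) (subst (suc (depth y) <_) (sym dx) (s≤s dy<k))
                           (inj₂ (y , reached y , e))

    parent-choice : ∀ x → Σ (Fin n) λ y → ∀ {k} → depth x ≡ suc k → depth y ≡ k × Edge T y x
    parent-choice x with depth x in dx
    ... | zero = x , λ ()
    ... | suc k with earlier-neighbour x dx
    ...   | y , dy , e = y , λ { refl → dy , e }

    bfs : Rooted T R
    bfs = record
      { root         = c
      ; depth        = depth
      ; parent       = λ x → proj₁ (parent-choice x)
      ; depth-≤      = λ x → proj₁ (proj₂ (first-reached x))
      ; depth-root   = n≤0⇒n≡0 (depth-≤ball {j = 0} refl)
      ; depth-zero   = λ x d0 → subst (λ t → Ball t x) d0 (reached x)
      ; parent-depth = λ {x} d → proj₁ (proj₂ (parent-choice x) d)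
      ; parent-edge  = λ {x} d → proj₂ (proj₂ (parent-choice x) d)
      }

module Ancestry {n} {T : Graph n} {R} (τ : Rooted T R) where
  open Rooted τ

  ParentOf : Fin n → Fin n → Set
  ParentOf a b = Σ ℕ λ k → depth b ≡ suc k × a ≡ parent b

  parentOf? : ∀ a b → Dec (ParentOf a b)
  parentOf? a b with depth b
  ... | zero  = no λ ()
  ... | suc k = map′ (λ a≡ → k , refl , a≡) (λ { (_ , refl , a≡) → a≡ }) (a ≟ᶠ parent b)

  ancestor : Fin n → ℕ → Fin n
  ancestor x zero = x
  ancestor x (suc i) = parent (ancestor x i)

  ancestor-depth : ∀ x i → i ≤ depth x → depth (ancestor x i) ≡ depth x ∸ i
  ancestor-depth x zero _ = refl
  ancestor-depth x (suc i) i<d =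
    parent-depth (trans (ancestor-depth x i (<⇒≤ i<d)) (∸≡suc∸suc i<d))

  ancestor-edge : ∀ x i → i < depth x → Edge T (ancestor x (suc i)) (ancestor x i)
  ancestor-edge x i i<d = parent-edge (trans (ancestor-depth x i (<⇒≤ i<d)) (∸≡suc∸suc i<d))

  -- The ancestors of x up to the root are pairwise distinct (their depths differ) ...
  ancestor-injective : ∀ x {i i'} → i ≤ depth x → i' ≤ depth x →
    ancestor x i ≡ ancestor x i' → i ≡ i'
  ancestor-injective x {i} {i'} i≤ i'≤ e = ∸-cancelˡ-≡ i≤ i'≤
    (trans (sym (ancestor-depth x i i≤)) (trans (cong depth e) (ancestor-depth x i' i'≤)))

  ancestor-root : ∀ x → ancestor x (depth x) ≡ root
  ancestor-root x = depth-zero _ (trans (ancestor-depth x (depth x) ≤-refl) (n∸n≡0 (depth x)))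

  -- An edge ab that is a parent edge in neither direction closes a cycle: go up from a to the
  -- first ancestor ancestor a I that is also an ancestor ancestor b j of b, then down to b.
  module MeetingCycle {a b : Fin n} (ab : Edge T a b)
      (¬ab : ¬ ParentOf a b) (¬ba : ¬ ParentOf b a)
      (I j : ℕ) (I≤ : I ≤ depth a) (j≤ : j ≤ depth b) (meet : ancestor b j ≡ ancestor a I)
      (first : ∀ i → i < I → ∀ t → t ≤ depth b → ancestor b t ≢ ancestor a i) where

    N : ℕ
    N = I + j

    walk : ℕ → Fin n
    walk k with k ≤? I
    ... | yes _ = ancestor a k
    ... | no _  = ancestor b (N ∸ k)

    walk-up : ∀ {k} → k ≤ I → walk k ≡ ancestor a k
    walk-up {k} k≤I with k ≤? I
    ... | yes _   = refl
    ... | no k≰I  = contradiction k≤I k≰I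

    walk-down : ∀ {k} → I ≤ k → walk k ≡ ancestor b (N ∸ k)
    walk-down {k} I≤k with k ≤? I
    ... | no _ = refl
    ... | yes k≤I with ≤-antisym k≤I I≤k
    ...   | refl = trans (sym meet) (cong (ancestor b) (sym (m+n∸m≡n I j)))

    ascending : ∀ {k} → ¬ I ≤ k → walk k ≡ ancestor a k
    ascending I≰k = walk-up (<⇒≤ (≰⇒> I≰k))

    up≤ : ∀ {k} → ¬ I ≤ k → k ≤ depth a
    up≤ I≰k = ≤-trans (<⇒≤ (≰⇒> I≰k)) I≤

    down≤ : ∀ {k} → I ≤ k → N ∸ k ≤ depth b
    down≤ {k} I≤k = ≤-trans (subst (N ∸ k ≤_) (m+n∸m≡n I j) (∸-monoʳ-≤ N I≤k)) j≤

    walk-edge : ∀ k → k < N → Edge T (walk k) (walk (suc k))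
    walk-edge k k<N with I ≤? k
    ... | no I≰k = subst₂ (Edge T) (sym (ascending I≰k)) (sym (walk-up (≰⇒> I≰k)))
                      (edge-sym T (ancestor-edge a k (<-≤-trans (≰⇒> I≰k) I≤)))
    ... | yes I≤k = subst₂ (Edge T) (sym (walk-down I≤k)) (sym (walk-down (m≤n⇒m≤1+n I≤k)))
                      (subst (λ t → Edge T (ancestor b t) (ancestor b (N ∸ suc k))) (sym N∸k)
                        (ancestor-edge b _ below))
      where
        N∸k : N ∸ k ≡ suc (N ∸ suc k)
        N∸k = ∸≡suc∸suc k<N
        below : N ∸ suc k < depth b
        below = subst (_≤ depth b) N∸k (down≤ I≤k)

    halves-disjoint : ∀ {i k} → ¬ I ≤ i → I ≤ k → walk i ≢ walk k
    halves-disjoint {i} I≰i I≤k e =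
      first i (≰⇒> I≰i) _ (down≤ I≤k)
        (sym (trans (sym (ascending I≰i)) (trans e (walk-down I≤k))))

    walk-injective : ∀ {k k'} → k ≤ N → k' ≤ N → walk k ≡ walk k' → k ≡ k'
    walk-injective {k} {k'} k≤N k'≤N e with I ≤? k | I ≤? k'
    ... | no I≰k  | no I≰k'  = ancestor-injective a (up≤ I≰k) (up≤ I≰k')
                                 (trans (sym (ascending I≰k)) (trans e (ascending I≰k')))
    ... | no I≰k  | yes I≤k' = contradiction e (halves-disjoint I≰k I≤k')
    ... | yes I≤k | no I≰k'  = contradiction (sym e) (halves-disjoint I≰k' I≤k)
    ... | yes I≤k | yes I≤k' = ∸-cancelˡ-≡ k≤N k'≤N
                                 (ancestor-injective b (down≤ I≤k) (down≤ I≤k')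
                                   (trans (sym (walk-down I≤k)) (trans e (walk-down I≤k'))))

    -- The walk has length at least 2: the short cases are a loop at a, or one of a and b being
    -- the parent of the other.
    long : 2 ≤ N
    long = at-least-two I j I≤ j≤ meet
      where
        at-least-two : ∀ I j → I ≤ depth a → j ≤ depth b → ancestor b j ≡ ancestor a I →
          2 ≤ I + j
        at-least-two zero zero _ _ b≡a = contradiction (subst (Edge T a) b≡a ab) (no-loop T)
        at-least-two zero (suc zero) _ 1≤ pb≡a with positive 1≤
        ... | k , db = contradiction (k , db , sym pb≡a) ¬ab
        at-least-two (suc zero) zero 1≤ _ b≡pa with positive 1≤
        ... | k , da = contradiction (k , da , b≡pa) ¬ba
        at-least-two zero (suc (suc _)) _ _ _ = s≤s (s≤s z≤n)
        at-least-two (suc zero) (suc _) _ _ _ = s≤s (s≤s z≤n)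
        at-least-two (suc (suc _)) _ _ _ _ = s≤s (s≤s z≤n)

    cycle : HasCycle T
    cycle = closedWalk⇒cycle T walk N long walk-injective walk-edge
      (subst₂ (Edge T) (sym (trans (walk-down (m≤m+n I j)) (cong (ancestor b) (n∸n≡0 N))))
                       (sym (walk-up z≤n)) (edge-sym T ab))

  parent-edges-only : Acyclic T → ∀ {a b} → Edge T a b → ParentOf a b ⊎ ParentOf b a
  parent-edges-only acyclic {a} {b} ab with parentOf? a b | parentOf? b a
  ... | yes p | _ = inj₁ p
  ... | no _  | yes q = inj₂ q
  ... | no ¬p | no ¬q with least meets? (depth a) at-root
    where
      Meets : ℕ → Set
      Meets i = Σ ℕ λ t → t ≤ depth b × ancestor b t ≡ ancestor a i
      meets? : Decidable Meets
      meets? i = map′ (λ (t , t<1+d , e) → t , s≤s⁻¹ t<1+d , e)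
                      (λ (t , t≤d , e) → t , s≤s t≤d , e)
                   (anyUpTo? (λ t → ancestor b t ≟ᶠ ancestor a i) (suc (depth b)))
      at-root : Meets (depth a)
      at-root = depth b , ≤-refl , trans (ancestor-root b) (sym (ancestor-root a))
  ...   | I , I≤ , (j , j≤ , meet) , first =
    contradiction (MeetingCycle.cycle ab ¬p ¬q I j I≤ j≤ meet
                     λ i i<I t t≤ e → first i i<I (t , t≤ , e)) acyclic

module Peeling {m} (G : Graph m) (d : ℕ) where

  degreeIn : (Fin m → Bool) → Fin m → ℕ
  degreeIn S w = count (λ u → adj G w u ∧ S u)

  core : ℕ → Fin m → Bool
  core zero u = true
  core (suc k) u = core k u ∧ does (d <? degreeIn (core k) u)

  survivor-degree : ∀ k {u} → core (suc k) u ≡ true → d < degreeIn (core k) u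
  survivor-degree k {u} alive = from-does (d <? _) (∧-conicalʳ (core k u) _ alive)

  deleted-degree : ∀ k {u} → core k u ≡ true → core (suc k) u ≡ false → degreeIn (core k) u ≤ d
  deleted-degree k {u} present gone = ≮⇒≥ λ d<deg →
    contradiction (trans (sym gone) (cong₂ _∧_ present (dec-true (d <? _) d<deg))) λ ()

  present-in-core : ∀ {u} K → (∀ j → j < K → core (suc j) u ≢ false) → core K u ≡ true
  present-in-core zero _ = refl
  present-in-core (suc k) kept = ¬-not (kept k ≤-refl)

  peeling-colouring : ∀ r' → (∀ v → core (suc r') v ≢ true) → Colourable G (suc r') d
  peeling-colouring r' empty = colour , bound
    where
      deletion : ∀ v → Σ ℕ λ k → k ≤ r' × Least (λ k → core (suc k) v ≡ false) k
      deletion v = least (λ k → core (suc k) v ≟ᵇ false) r' (¬-not (empty v))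

      round : Fin m → ℕ
      round v = proj₁ (deletion v)

      colour : Fin m → Fin (suc r')
      colour v = fromℕ< (s≤s (proj₁ (proj₂ (deletion v))))

      same-round : ∀ {u v} → colour u ≡ colour v → round u ≡ round v
      same-round e = trans (sym (toℕ-fromℕ< _)) (trans (cong toℕ e) (toℕ-fromℕ< _))

      present : ∀ v → core (round v) v ≡ true
      present v = present-in-core (round v) (proj₂ (proj₂ (proj₂ (deletion v))))

      like-coloured-present : ∀ v u → adj G v u ∧ does (colour u ≟ᶠ colour v) ≡ true →
        adj G v u ∧ core (round v) u ≡ true
      like-coloured-present v u e with adj G v u | colour u ≟ᶠ colour v
      ... | true | yes same = subst (λ k → core k u ≡ true) (same-round same) (present u)

      bound : ∀ v → sameColourDeg G colour v ≤ d
      bound v = ≤-trans (countIn-mono (allFin m) (like-coloured-present v))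
                  (deleted-degree (round v) (present v) (proj₁ (proj₂ (proj₂ (deletion v)))))

module Embedding {n} {T : Graph n} {R} (τ : Rooted T R)
    (tree-like : ∀ {a b} → Edge T a b → Ancestry.ParentOf τ a b ⊎ Ancestry.ParentOf τ b a)
    {m} (G : Graph m) (d : ℕ) (small : n ≤ 2 + d) where
  open Rooted τ
  open Peeling G d

  -- Enumerations of vertices of T in which parents come before children (latest first).
  data Growing : List (Fin n) → Set where
    start : Growing (root ∷ [])
    grow  : ∀ {x k ℓ} → Growing ℓ → x ∉ ℓ → depth x ≡ suc k → parent x ∈ ℓ → Growing (x ∷ ℓ)

  growing-unique : ∀ {ℓ} → Growing ℓ → Unique ℓ
  growing-unique start = ¬Any⇒All¬ [] (λ ()) ∷ []
  growing-unique (grow gr x∉ _ _) = ¬Any⇒All¬ _ x∉ ∷ growing-unique gr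

  growing-closed : ∀ {ℓ y k} → Growing ℓ → y ∈ ℓ → depth y ≡ suc k → parent y ∈ ℓ
  growing-closed start (here refl) dy = contradiction (trans (sym depth-root) dy) λ ()
  growing-closed (grow _ _ _ px∈) (here refl) _ = there px∈
  growing-closed (grow gr _ _ _) (there y∈) dy = there (growing-closed gr y∈ dy)

  record Embeds (ℓ : List (Fin n)) (g : Fin n → Fin m) : Set where
    field
      injective-on : ∀ {x y} → x ∈ ℓ → y ∈ ℓ → g x ≡ g y → x ≡ y
      parent-edges : ∀ {x k} → x ∈ ℓ → depth x ≡ suc k → Edge G (g (parent x)) (g x)
      in-core      : ∀ {x} → x ∈ ℓ → core (R ∸ depth x) (g x) ≡ true

  _[_↦_] : (Fin n → Fin m) → Fin n → Fin m → Fin n → Fin m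
  (g [ x ↦ u ]) y = if does (y ≟ᶠ x) then u else g y

  ↦-new : ∀ {g x u} → (g [ x ↦ u ]) x ≡ u
  ↦-new {x = x} rewrite dec-true (x ≟ᶠ x) refl = refl

  ↦-old : ∀ {g x u y} → y ≢ x → (g [ x ↦ u ]) y ≡ g y
  ↦-old {x = x} {y = y} y≢x rewrite dec-false (y ≟ᶠ x) y≢x = refl

  -- The image w of the parent of a new vertex x of depth k + 1 lies in
  -- core (R ∸ k) = core (suc (R ∸ suc k)), so w has more than d ≥ |ℓ| - 1 neighbours in
  -- core (R ∸ suc k); one of them is not yet used.
  choose : ∀ {ℓ x k g} → Growing ℓ → x ∉ ℓ → depth x ≡ suc k → parent x ∈ ℓ → Embeds ℓ g →
    Σ (Fin m) λ u → (adj G (g (parent x)) u ∧ core (R ∸ suc k) u ≡ true) × u ∉ map g ℓ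
  choose {ℓ} {x} {k} {g} gr x∉ dx px∈ emb = fresh P (∈-map⁺ g px∈) P-parent enough
    where
      open Embeds emb
      w : Fin m
      w = g (parent x)
      P : Fin m → Bool
      P u = adj G w u ∧ core (R ∸ suc k) u
      P-parent : P w ≡ false
      P-parent rewrite irrefl G w = refl
      k<R : k < R
      k<R = subst (_≤ R) dx (depth-≤ x)
      w-core : core (suc (R ∸ suc k)) w ≡ true
      w-core = subst (λ t → core t w ≡ true)
                 (trans (cong (R ∸_) (parent-depth dx)) (∸≡suc∸suc k<R)) (in-core px∈)
      enough : length (map g ℓ) ≤ count P
      enough = begin
        length (map g ℓ)  ≡⟨ length-map g ℓ ⟩
        length ℓ          ≤⟨ s≤s⁻¹ (≤-trans (unique-length (growing-unique x∷ℓ)) small) ⟩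
        suc d             ≤⟨ survivor-degree (R ∸ suc k) w-core ⟩
        count P           ∎
        where
          open ≤-Reasoning
          x∷ℓ : Growing (x ∷ ℓ)
          x∷ℓ = grow gr x∉ dx px∈

  extend : ∀ {ℓ x k g u} → Growing ℓ → x ∉ ℓ → depth x ≡ suc k → parent x ∈ ℓ → Embeds ℓ g →
    u ∉ map g ℓ → Edge G (g (parent x)) u → core (R ∸ suc k) u ≡ true →
    Embeds (x ∷ ℓ) (g [ x ↦ u ])
  extend {ℓ} {x} {k} {g} {u} gr x∉ dx px∈ emb u∉ u-edge u-core =
    record { injective-on = injective ; parent-edges = edges ; in-core = cores }
    where
      open Embeds emb
      g' : Fin n → Fin m
      g' = g [ x ↦ u ]
      new : g' x ≡ u
      new = ↦-new {g} {x} {u}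
      old : ∀ {y} → y ∈ ℓ → g' y ≡ g y
      old y∈ = ↦-old {g} {x} {u} λ { refl → x∉ y∈ }
      unused : ∀ {y} → y ∈ ℓ → u ≢ g y
      unused y∈ u≡ = u∉ (subst (_∈ map g ℓ) (sym u≡) (∈-map⁺ g y∈))
      injective : ∀ {y z} → y ∈ x ∷ ℓ → z ∈ x ∷ ℓ → g' y ≡ g' z → y ≡ z
      injective (here refl) (here refl) _ = refl
      injective (here refl) (there z∈) e =
        contradiction (trans (sym new) (trans e (old z∈))) (unused z∈)
      injective (there y∈) (here refl) e =
        contradiction (trans (sym new) (trans (sym e) (old y∈))) (unused y∈)
      injective (there y∈) (there z∈) e =
        injective-on y∈ z∈ (trans (sym (old y∈)) (trans e (old z∈)))
      edges : ∀ {y k'} → y ∈ x ∷ ℓ → depth y ≡ suc k' → Edge G (g' (parent y)) (g' y)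
      edges (here refl) _ = subst₂ (Edge G) (sym (old px∈)) (sym new) u-edge
      edges (there y∈) dy = subst₂ (Edge G) (sym (old (growing-closed gr y∈ dy))) (sym (old y∈))
                              (parent-edges y∈ dy)
      cores : ∀ {y} → y ∈ x ∷ ℓ → core (R ∸ depth y) (g' y) ≡ true
      cores (here refl) = subst₂ (λ t w → core (R ∸ t) w ≡ true) (sym dx) (sym new) u-core
      cores {y} (there y∈) = subst (λ w → core (R ∸ depth y) w ≡ true) (sym (old y∈)) (in-core y∈)

  greedy : ∀ {v} → core R v ≡ true → ∀ {ℓ} → Growing ℓ → Σ (Fin n → Fin m) (Embeds ℓ)
  greedy {v} v-core start = (λ _ → v) , record
    { injective-on = λ { (here refl) (here refl) _ → refl }
    ; parent-edges = λ { (here refl) d → contradiction (trans (sym depth-root) d) λ () }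
    ; in-core      = λ { (here refl) → subst (λ t → core (R ∸ t) v ≡ true) (sym depth-root) v-core }
    }
  greedy v-core (grow {x} gr x∉ dx px∈) with greedy v-core gr
  ... | g , emb with choose gr x∉ dx px∈ emb
  ...   | u , u-ok , u∉ =
    g [ x ↦ u ] , extend gr x∉ dx px∈ emb u∉ (∧-conicalˡ _ _ u-ok) (∧-conicalʳ _ _ u-ok)

  at-depth? : ∀ k → Decidable (λ x → depth x ≡ k)
  at-depth? k x = depth x ≟ k

  layer : ℕ → List (Fin n)
  layer k = filter (at-depth? k) (allFin n)

  upto : ℕ → List (Fin n)
  upto zero = root ∷ []
  upto (suc k) = layer (suc k) ++ upto k

  upto-sound : ∀ k {y} → y ∈ upto k → depth y ≤ k
  upto-sound zero (here refl) = ≤-reflexive depth-root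
  upto-sound (suc k) y∈ with ∈-++⁻ (layer (suc k)) y∈
  ... | inj₁ y∈layer = ≤-reflexive (proj₂ (∈-filter⁻ (at-depth? (suc k)) {xs = allFin n} y∈layer))
  ... | inj₂ y∈upto  = m≤n⇒m≤1+n (upto-sound k y∈upto)

  upto-complete : ∀ k {y} → depth y ≤ k → y ∈ upto k
  upto-complete zero dy = here (depth-zero _ (n≤0⇒n≡0 dy))
  upto-complete (suc k) {y} dy with m≤n⇒m<n∨m≡n dy
  ... | inj₁ dy<k+1 = ∈-++⁺ʳ (layer (suc k)) (upto-complete k (s≤s⁻¹ dy<k+1))
  ... | inj₂ dy≡k+1 = ∈-++⁺ˡ (∈-filter⁺ (at-depth? (suc k)) (∈-allFin y) dy≡k+1)

  grow-layer : ∀ {k ℓ} xs → Growing ℓ → Unique xs → (∀ {x} → x ∈ xs → depth x ≡ suc k) →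
    (∀ {y} → y ∈ ℓ → depth y ≤ k) → (∀ {y} → depth y ≤ k → y ∈ ℓ) → Growing (xs ++ ℓ)
  grow-layer [] gr _ _ _ _ = gr
  grow-layer {k} {ℓ} (x ∷ xs) gr (x≢xs ∷ xs!) deep sound complete =
    grow (grow-layer xs gr xs! (λ x∈ → deep (there x∈)) sound complete) new dx
      (∈-++⁺ʳ xs (complete (≤-reflexive (parent-depth dx))))
    where
      dx : depth x ≡ suc k
      dx = deep (here refl)
      new : x ∉ xs ++ ℓ
      new x∈ with ∈-++⁻ xs x∈
      ... | inj₁ x∈xs = lookup x≢xs x∈xs refl
      ... | inj₂ x∈ℓ  = <-irrefl refl (subst (_≤ k) dx (sound x∈ℓ))

  upto-growing : ∀ k → Growing (upto k)
  upto-growing zero = start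
  upto-growing (suc k) =
    grow-layer (layer (suc k)) (upto-growing k)
      (filter⁺ (at-depth? (suc k)) {allFin n} (allFin⁺ n))
      (λ x∈ → proj₂ (∈-filter⁻ (at-depth? (suc k)) {xs = allFin n} x∈))
      (upto-sound k) (upto-complete k)

  embedding : ∀ {v} → core R v ≡ true → ContainsSubgraph G T
  embedding v-core = g , (λ {x} {y} → injective-on (everything x) (everything y)) , edges
    where
      everything : ∀ x → x ∈ upto R
      everything x = upto-complete R (depth-≤ x)
      embedded : Σ (Fin n → Fin m) (Embeds (upto R))
      embedded = greedy v-core (upto-growing R)
      g : Fin n → Fin m
      g = proj₁ embedded
      open Embeds (proj₂ embedded)
      edges : ∀ a b → Edge T a b → Edge G (g a) (g b)
      edges a b ab with tree-like ab
      ... | inj₁ (_ , db , refl) = parent-edges (everything b) db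
      ... | inj₂ (_ , da , refl) = edge-sym G (parent-edges (everything a) da)

-- The radius gives a rooting of T of depth ≤ r, acyclicity makes all its edges parent edges,
-- and T-freeness empties core r for d = n - 2.
proposition37 : (n r : ℕ) (T : Graph n) → 2 ≤ n → 1 ≤ r →
    IsTree T → HasRadius T r →
    (m : ℕ) (G : Graph m) → ¬ ContainsSubgraph G T →
    Colourable G r (n ∸ 2)
proposition37 n (suc r') T _ _ (_ , acyclic) ((centre , near) , _) m G T-free =
  peeling-colouring r' λ v v-core →
    T-free (Embedding.embedding τ tree-like G (n ∸ 2) n≤2+[n∸2] v-core)
  where
    open Peeling G (n ∸ 2)
    τ : Rooted T (suc r')
    τ = BreadthFirst.bfs T centre near
    tree-like : ∀ {a b} → Edge T a b → Ancestry.ParentOf τ a b ⊎ Ancestry.ParentOf τ b a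
    tree-like = Ancestry.parent-edges-only τ acyclic
    n≤2+[n∸2] : n ≤ 2 + (n ∸ 2)
    n≤2+[n∸2] = m≤n+m∸n n 2
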